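{- If $G$ and $H$ are connected graphs, then ${\rm gp}(G\boxtimes H) \le \min\{n(G)\,{\rm gp}(H),\ n(H)\,{\rm gp}(G)\}$.
   Context: All graphs are finite and simple; $n(X)=|V(X)|$. The strong product $G\boxtimes H$ has vertex set $V(G)\times V(H)$, with distinct $(g,h),(g',h')$ adjacent iff ($g=g'$ or $gg'\in E(G)$) and ($h=h'$ or $hh'\in E(H)$). For a connected graph $X$, a set $S\subseteq V(X)$ is a general position set if no three pairwise distinct vertices of $S$ lie on a common geodesic of $X$; ${\rm gp}(X)$ is the maximum cardinality of a general position set. -}

module Defs where

open import Data.Nat using (ℕ; _*_; _≤_)
open import Data.Fin using (Fin; remQuot)
open import Data.Fin.Subset using (Subset; _∈_; ∣_∣)
open import Data.List using (List; []; _∷_; length)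
open import Data.List.Membership.Propositional renaming (_∈_ to _∈ₗ_)
open import Data.Product using (Σ; ∃; ∃-syntax; _×_; _,_; proj₁; proj₂)
open import Data.Sum using (_⊎_; inj₁; inj₂)
open import Relation.Binary.PropositionalEquality using (_≡_; _≢_; refl; sym)
open import Relation.Nullary using (¬_)

record Graph : Set₁ where
  field
    n      : ℕ
    Adj    : Fin n → Fin n → Set
    adj-sym : ∀ {u v} → Adj u v → Adj v u
    irrefl : ∀ {u} → ¬ Adj u u

open Graph public

order : Graph → ℕ
order G = n G

module _ (G : Graph) where
  private V = Fin (n G)

  -- IsWalk u v p : the vertex list p is a walk from u to v in G.
  -- Its length (number of edges) is length p - 1.
  data IsWalk : V → V → List V → Set where
    single : ∀ {u} → IsWalk u u (u ∷ [])
    step   : ∀ {u w v p} → Adj G u w → IsWalk w v p → IsWalk u v (u ∷ p)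

  Connected : Set
  Connected = ∀ u v → ∃[ p ] IsWalk u v p

  IsGeodesic : V → V → List V → Set
  IsGeodesic u v p = IsWalk u v p × (∀ q → IsWalk u v q → length p ≤ length q)

  OnCommonGeodesic : V → V → V → Set
  OnCommonGeodesic x y z =
    ∃[ u ] ∃[ v ] ∃[ p ] (IsGeodesic u v p × x ∈ₗ p × y ∈ₗ p × z ∈ₗ p)

  IsGPSet : Subset (n G) → Set
  IsGPSet S = ∀ x y z → x ∈ S → y ∈ S → z ∈ S →
              x ≢ y → y ≢ z → x ≢ z → ¬ OnCommonGeodesic x y z

  IsGPNumber : ℕ → Set
  IsGPNumber k = (∃[ S ] (IsGPSet S × ∣ S ∣ ≡ k))
               × (∀ S → IsGPSet S → ∣ S ∣ ≤ k)

EqOrAdj : (G : Graph) → Fin (n G) → Fin (n G) → Set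
EqOrAdj G u v = u ≡ v ⊎ Adj G u v

private
  eqOrAdj-sym : ∀ G {u v} → EqOrAdj G u v → EqOrAdj G v u
  eqOrAdj-sym G (inj₁ e) = inj₁ (sym e)
  eqOrAdj-sym G (inj₂ a) = inj₂ (adj-sym G a)

-- Strong product G ⊠ H, vertex set Fin (n G * n H) ≅ Fin (n G) × Fin (n H)
-- via remQuot / combine.
_⊠_ : Graph → Graph → Graph
G ⊠ H = record
  { n      = n G * n H
  ; Adj    = λ a b → a ≢ b
                   × EqOrAdj G (proj₁ (remQuot {n G} (n H) a)) (proj₁ (remQuot {n G} (n H) b))
                   × EqOrAdj H (proj₂ (remQuot {n G} (n H) a)) (proj₂ (remQuot {n G} (n H) b))
  ; adj-sym = λ { (ne , g , h) → (λ e → ne (sym e)) , eqOrAdj-sym G g , eqOrAdj-sym H h }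
  ; irrefl = λ { (ne , _) → ne refl }
  }

module Submission where

-- Write V(G ⊠ H) = V(G) × V(H).  For a fixed vertex g of G the
-- "H-layer" {g} × H is a retract of G ⊠ H: the embedding h ↦ (g , h) maps
-- edges to edges, and the projection onto the H-coordinate maps every edge of
-- G ⊠ H to an edge or a single vertex of H.  Hence projecting a walk never
-- makes it longer, so the embedding carries geodesics of H to geodesics of
-- G ⊠ H, and the trace on the layer of a general position set of G ⊠ H is a
-- general position set of H, of size at most gp(H).  The n(G) H-layers
-- partition V(G ⊠ H), so |S| ≤ n(G) · gp(H); symmetrically, using the
-- n(H) G-layers, |S| ≤ n(H) · gp(G).  The argument does not need the
-- connectedness hypotheses.

open import Defs
open import Data.Nat using (ℕ; zero; suc; _+_; _*_; _≤_; _⊓_; z≤n; s≤s)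
open import Data.Nat.Properties
  using (≤-trans; ≤-refl; n≤1+n; +-mono-≤; +-assoc; ⊓-glb; +-0-commutativeMonoid)
open import Data.Bool using (Bool; true; false)
open import Data.Fin using (Fin; zero; suc; remQuot; combine; _↑ˡ_; _↑ʳ_)
open import Data.Fin.Properties using (remQuot-combine; combine-injectiveˡ; combine-injectiveʳ)
open import Data.Fin.Subset using (Subset; _∈_; ∣_∣)
open import Data.Vec using ([]; _∷_; lookup; tabulate)
open import Data.Vec.Properties using (lookup∘tabulate; []=⇒lookup; lookup⇒[]=)
open import Data.List using (List; length; map)
open import Data.List.Properties using (length-map)
open import Data.List.Membership.Propositional.Properties using (∈-map⁺)
open import Data.Product using (Σ; _×_; _,_; proj₁; proj₂)
open import Data.Sum using (inj₁; inj₂)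
open import Function using (_∘_)
open import Relation.Binary.PropositionalEquality
  using (_≡_; _≢_; refl; sym; trans; cong; subst; subst₂; module ≡-Reasoning)
open import Algebra.Properties.CommutativeMonoid.Sum +-0-commutativeMonoid
  using (sum; sum-cong-≗; ∑-comm)

V : Graph → Set
V X = Fin (n X)

adj-≢ : ∀ X {x y} → Adj X x y → x ≢ y
adj-≢ X x~y refl = irrefl X x~y

preimage : ∀ {k N} → (Fin k → Fin N) → Subset N → Subset k
preimage σ S = tabulate (lookup S ∘ σ)

∈-preimage : ∀ {k N} (σ : Fin k → Fin N) (S : Subset N) {x} →
             x ∈ preimage σ S → σ x ∈ S
∈-preimage σ S {x} x∈ =
  lookup⇒[]= (σ x) S (trans (sym (lookup∘tabulate (lookup S ∘ σ) x)) ([]=⇒lookup x∈))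

module Retraction (H P : Graph)
  (σ : V H → V P) (ρ : V P → V H)
  (ρ∘σ : ∀ h → ρ (σ h) ≡ h)
  (σ-adj : ∀ {h h'} → Adj H h h' → Adj P (σ h) (σ h'))
  (ρ-adj : ∀ {a b} → Adj P a b → EqOrAdj H (ρ a) (ρ b))
  where

  σ-injective : ∀ {x y} → x ≢ y → σ x ≢ σ y
  σ-injective {x} {y} x≢y σx≡σy =
    x≢y (trans (sym (ρ∘σ x)) (trans (cong ρ σx≡σy) (ρ∘σ y)))

  map-walk : ∀ {u v p} → IsWalk H u v p → IsWalk P (σ u) (σ v) (map σ p)
  map-walk single       = single
  map-walk (step a w)   = step (σ-adj a) (map-walk w)

  project-walk : ∀ {a b q} → IsWalk P a b q →
                 Σ (List (V H)) λ q' → IsWalk H (ρ a) (ρ b) q' × length q' ≤ length q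
  project-walk single = _ , single , ≤-refl
  project-walk {b = b} (step ad w) with project-walk w | ρ-adj ad
  ... | q' , w' , q'≤q | inj₁ ρa≡ρw =
    q' , subst (λ x → IsWalk H x (ρ b) q') (sym ρa≡ρw) w' , ≤-trans q'≤q (n≤1+n _)
  ... | q' , w' , q'≤q | inj₂ ρa~ρw = _ , step ρa~ρw w' , s≤s q'≤q

  map-geodesic : ∀ {u v p} → IsGeodesic H u v p → IsGeodesic P (σ u) (σ v) (map σ p)
  map-geodesic {u} {v} {p} (w , shortest) = map-walk w , λ q wq → lengths q wq
    where
    lengths : ∀ q → IsWalk P (σ u) (σ v) q → length (map σ p) ≤ length q
    lengths q wq with project-walk wq
    ... | q' , wq' , q'≤q rewrite ρ∘σ u | ρ∘σ v | length-map σ p =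
      ≤-trans (shortest q' wq') q'≤q

  preimage-GP : ∀ S → IsGPSet P S → IsGPSet H (preimage σ S)
  preimage-GP S gp x y z x∈ y∈ z∈ x≢y y≢z x≢z (u , v , p , geo , x∈p , y∈p , z∈p) =
    gp (σ x) (σ y) (σ z) (∈-preimage σ S x∈) (∈-preimage σ S y∈) (∈-preimage σ S z∈)
       (σ-injective x≢y) (σ-injective y≢z) (σ-injective x≢z)
       (σ u , σ v , map σ p , map-geodesic geo , ∈-map⁺ σ x∈p , ∈-map⁺ σ y∈p , ∈-map⁺ σ z∈p)

  preimage-≤-gp : ∀ {k} S → IsGPNumber H k → IsGPSet P S → ∣ preimage σ S ∣ ≤ k
  preimage-≤-gp S (_ , maximal) gp = maximal (preimage σ S) (preimage-GP S gp)

indicator : Bool → ℕ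
indicator true  = 1
indicator false = 0

∣∣-sum : ∀ {N} (S : Subset N) → ∣ S ∣ ≡ sum (indicator ∘ lookup S)
∣∣-sum []          = refl
∣∣-sum (true ∷ S)  = cong suc (∣∣-sum S)
∣∣-sum (false ∷ S) = ∣∣-sum S

∣preimage∣-sum : ∀ {k N} (σ : Fin k → Fin N) (S : Subset N) →
                 ∣ preimage σ S ∣ ≡ sum (indicator ∘ lookup S ∘ σ)
∣preimage∣-sum σ S =
  trans (∣∣-sum (preimage σ S)) (sum-cong-≗ λ h → cong indicator (lookup∘tabulate (lookup S ∘ σ) h))

sum-≤ : ∀ {m} (f : Fin m → ℕ) c → (∀ i → f i ≤ c) → sum f ≤ m * c
sum-≤ {zero}  f c f≤c = z≤n
sum-≤ {suc m} f c f≤c = +-mono-≤ (f≤c zero) (sum-≤ (f ∘ suc) c (f≤c ∘ suc))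

sum-↑ : ∀ a b (f : Fin (a + b) → ℕ) →
        sum f ≡ sum (λ i → f (i ↑ˡ b)) + sum (λ j → f (a ↑ʳ j))
sum-↑ zero    b f = refl
sum-↑ (suc a) b f =
  trans (cong (f zero +_) (sum-↑ a b (f ∘ suc))) (sym (+-assoc (f zero) _ _))

row : ∀ m k → Fin m → Fin k → Fin (m * k)
row m k g h = combine g h

column : ∀ m k → Fin k → Fin m → Fin (m * k)
column m k h g = combine g h

sum-combine : ∀ m k (f : Fin (m * k) → ℕ) →
              sum f ≡ sum (λ g → sum (f ∘ row m k g))
sum-combine zero    k f = refl
sum-combine (suc m) k f =
  trans (sum-↑ k (m * k) f) (cong (sum (λ h → f (h ↑ˡ (m * k))) +_) (sum-combine m k (f ∘ (k ↑ʳ_))))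

count-rows : ∀ m k (S : Subset (m * k)) →
             ∣ S ∣ ≡ sum (λ g → ∣ preimage (row m k g) S ∣)
count-rows m k S = begin
  ∣ S ∣                                               ≡⟨ ∣∣-sum S ⟩
  sum (indicator ∘ lookup S)                          ≡⟨ sum-combine m k _ ⟩
  sum (λ g → sum (indicator ∘ lookup S ∘ row m k g))  ≡⟨ sum-cong-≗ (λ g → sym (∣preimage∣-sum (row m k g) S)) ⟩
  sum (λ g → ∣ preimage (row m k g) S ∣)              ∎
  where open ≡-Reasoning

count-columns : ∀ m k (S : Subset (m * k)) →
                ∣ S ∣ ≡ sum (λ h → ∣ preimage (column m k h) S ∣)
count-columns m k S = begin
  ∣ S ∣                                                    ≡⟨ count-rows m k S ⟩
  sum (λ g → ∣ preimage (row m k g) S ∣)                   ≡⟨ sum-cong-≗ (λ g → ∣preimage∣-sum (row m k g) S) ⟩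
  sum (λ g → sum (λ h → indicator (lookup S (row m k g h)))) ≡⟨ ∑-comm (λ g h → indicator (lookup S (row m k g h))) ⟩
  sum (λ h → sum (λ g → indicator (lookup S (row m k g h)))) ≡⟨ sum-cong-≗ (λ h → sym (∣preimage∣-sum (column m k h) S)) ⟩
  sum (λ h → ∣ preimage (column m k h) S ∣)                ∎
  where open ≡-Reasoning

rows-bound : ∀ m k (S : Subset (m * k)) c →
             (∀ g → ∣ preimage (row m k g) S ∣ ≤ c) → ∣ S ∣ ≤ m * c
rows-bound m k S c row≤c =
  subst (_≤ m * c) (sym (count-rows m k S)) (sum-≤ (λ g → ∣ preimage (row m k g) S ∣) c row≤c)

columns-bound : ∀ m k (S : Subset (m * k)) c →
                (∀ h → ∣ preimage (column m k h) S ∣ ≤ c) → ∣ S ∣ ≤ k * c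
columns-bound m k S c column≤c =
  subst (_≤ k * c) (sym (count-columns m k S)) (sum-≤ (λ h → ∣ preimage (column m k h) S ∣) c column≤c)

-- The layers of the strong product.  A vertex of G ⊠ H is decoded by remQuot
-- into its G- and H-coordinates; the H-layer through g is row g and the
-- G-layer through h is column h.
module Layers (G H : Graph) where

  private
    m = n G
    k = n H

  coord-G : V (G ⊠ H) → V G
  coord-G a = proj₁ (remQuot {m} k a)

  coord-H : V (G ⊠ H) → V H
  coord-H a = proj₂ (remQuot {m} k a)

  coord-G-row : ∀ g h → coord-G (row m k g h) ≡ g
  coord-G-row g h = cong proj₁ (remQuot-combine g h)

  coord-H-row : ∀ g h → coord-H (row m k g h) ≡ h
  coord-H-row g h = cong proj₂ (remQuot-combine g h)

  row-adj : ∀ g {h h'} → Adj H h h' → Adj (G ⊠ H) (row m k g h) (row m k g h')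
  row-adj g {h} {h'} h~h' =
    (λ e → adj-≢ H h~h' (combine-injectiveʳ g h g h' e)) ,
    inj₁ (trans (coord-G-row g h) (sym (coord-G-row g h'))) ,
    inj₂ (subst₂ (Adj H) (sym (coord-H-row g h)) (sym (coord-H-row g h')) h~h')

  column-adj : ∀ h {g g'} → Adj G g g' → Adj (G ⊠ H) (column m k h g) (column m k h g')
  column-adj h {g} {g'} g~g' =
    (λ e → adj-≢ G g~g' (combine-injectiveˡ g h g' h e)) ,
    inj₂ (subst₂ (Adj G) (sym (coord-G-row g h)) (sym (coord-G-row g' h)) g~g') ,
    inj₁ (trans (coord-H-row g h) (sym (coord-H-row g' h)))

  module HLayer (g : V G) =
    Retraction H (G ⊠ H) (row m k g) coord-H (coord-H-row g) (row-adj g) (λ a~b → proj₂ (proj₂ a~b))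
  module GLayer (h : V H) =
    Retraction G (G ⊠ H) (column m k h) coord-G (λ g → coord-G-row g h) (column-adj h) (λ a~b → proj₁ (proj₂ a~b))

corollary4p1 : (G H : Graph) → Connected G → Connected H →
    (gpG gpH gpGH : ℕ) →
    IsGPNumber G gpG → IsGPNumber H gpH → IsGPNumber (G ⊠ H) gpGH →
    gpGH ≤ (order G * gpH) ⊓ (order H * gpG)
corollary4p1 G H _ _ gpG gpH _ isGP-G isGP-H ((S , S-GP , refl) , _) =
  ⊓-glb (rows-bound (n G) (n H) S gpH λ g → HLayer.preimage-≤-gp g S isGP-H S-GP)
        (columns-bound (n G) (n H) S gpG λ h → GLayer.preimage-≤-gp h S isGP-G S-GP)
  where open Layers G H
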